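{- Let $\varepsilon\colon X^{\times}_{\mathrm{irr}}\to\mathcal{P}(M)$ be a Fitch map. Then $\mathcal{N}[\varepsilon]$ is hierarchy-like (i.e. $\varepsilon$ satisfies the hierarchy-like-condition), and $\mathcal{N}[\varepsilon]\subseteq\mathcal{C}(T)$ for every edge-labeled tree $(T,\lambda)$ that explains $\varepsilon$.
   Context: $X$ is a finite nonempty set, $M$ a finite nonempty set of colors, $X^{\times}_{\mathrm{irr}}=\{(x,y)\in X\times X: x\neq y\}$. A phylogenetic tree on $X$ is a rooted tree whose leaves (non-root vertices of degree $1$) form $X$, whose root has degree $\ge2$ and whose non-root inner vertices have degree $\ge3$. $v\preceq w$ means $v$ lies on the path from the root to $w$; $\mathrm{lca}(x,y)$ is the $\preceq$-maximal common ancestor of $x,y$. The cluster of a vertex $v$ is $C_T(v)=\{x\in X: v\preceq x\}$ and $\mathcal{C}(T)=\{C_T(v): v\in V(T)\}$. An edge-labeled tree $(T,\lambda)$ on $X$ with $M$ is a phylogenetic tree $T$ on $X$ with $\lambda\colon E(T)\to\mathcal{P}(M)$; $e$ is an $m$-edge if $m\in\lambda(e)$. $(T,\lambda)$ explains $\varepsilon\colon X^{\times}_{\mathrm{irr}}\to\mathcal{P}(M)$ if for all $(x,y)\in X^{\times}_{\mathrm{irr}}$, $m\in M$: $m\in\varepsilon(x,y)$ iff the path from $\mathrm{lca}(x,y)$ to $y$ contains an $m$-edge; $\varepsilon$ is a Fitch map if some edge-labeled tree explains it. $N_m[y]=\{x\in X\setminus\{y\}: m\notin\varepsilon(x,y)\}\cup\{y\}$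 and $\mathcal{N}[\varepsilon]=\{N_m[y]: y\in X, m\in M\}$. A set system $\mathcal{H}\subseteq\mathcal{P}(X)$ is hierarchy-like if $P\cap Q\in\{P,Q,\emptyset\}$ for all $P,Q\in\mathcal{H}$. -}

module Defs where

open import Data.Nat using (ℕ)
open import Data.Fin using (Fin)
open import Data.Fin.Subset using (Subset; _∈_; _∉_)
open import Data.Maybe using (Maybe; just; nothing)
open import Data.Product using (Σ; ∃; ∃-syntax; _×_; _,_)
open import Data.Sum using (_⊎_)
open import Relation.Binary.PropositionalEquality using (_≡_; _≢_)
open import Relation.Unary using (Pred; _∩_; _≐_; Empty)
open import Function.Bundles using (_⇔_)
open import Level using (0ℓ)

module _ {V : ℕ} (parent : Fin V → Maybe (Fin V)) where

  data Anc (u : Fin V) : Fin V → Set where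
    anc-refl : Anc u u
    anc-step : ∀ {p w} → Anc u p → parent w ≡ just p → Anc u w

-- A phylogenetic tree on X = Fin n.
-- Vertex v ≠ root has the edge {parent v , v}; edges ↔ non-root vertices.
record PhyloTree (n : ℕ) : Set where
  field
    V      : ℕ
    root   : Fin V
    parent : Fin V → Maybe (Fin V)
    root-parent    : parent root ≡ nothing
    nonroot-parent : ∀ v → v ≢ root → ∃[ p ] parent v ≡ just p
    -- every vertex is a descendant of the root (so the parent map is a
    -- rooted tree: no cycles)
    root-anc       : ∀ v → Anc parent root v
    -- the leaves (non-root vertices of degree 1, i.e. without children)
    -- are exactly the elements of X, via the injective map leaf
    leaf           : Fin n → Fin V
    leaf-inj       : ∀ x y → leaf x ≡ leaf y → x ≡ y
    leaf-nonroot   : ∀ x → leaf x ≢ root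
    leaf-childless : ∀ x w → parent w ≢ just (leaf x)
    childless-leaf : ∀ v → v ≢ root → (∀ w → parent w ≢ just v) →
                     ∃[ x ] leaf x ≡ v
    -- degree conditions: the root has degree ≥ 2 and every non-root inner
    -- vertex has degree ≥ 3, i.e. every non-leaf vertex has ≥ 2 children
    branching      : ∀ v → (∀ x → leaf x ≢ v) →
                     ∃[ w₁ ] ∃[ w₂ ] (w₁ ≢ w₂ × parent w₁ ≡ just v × parent w₂ ≡ just v)

module _ {n : ℕ} (T : PhyloTree n) where
  open PhyloTree T

  _⪯_ : Fin V → Fin V → Set
  u ⪯ w = Anc parent u w

  IsLCA : Fin V → Fin V → Fin V → Set
  IsLCA v a b = v ⪯ a × v ⪯ b × (∀ w → w ⪯ a → w ⪯ b → w ⪯ v)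

  Cluster : Fin V → Pred (Fin n) 0ℓ
  Cluster v x = v ⪯ leaf x

  InClusters : Pred (Fin n) 0ℓ → Set
  InClusters N = ∃[ v ] N ≐ Cluster v

  -- (T, lab) explains ε, where lab v is the label λ of the edge {parent v, v}
  -- (its value at the root is irrelevant).  The path from lca(x,y) to y
  -- contains the edge {parent w , w} iff lca(x,y) ⪯ w ⪯ leaf y and w ≠ lca(x,y).
  Explains : ∀ {k} → (Fin V → Subset k) → (Fin n → Fin n → Subset k) → Set
  Explains {k} lab ε =
    ∀ (x y : Fin n) → x ≢ y → ∀ (m : Fin k) → ∀ v → IsLCA v (leaf x) (leaf y) →
      (m ∈ ε x y ⇔ (∃[ w ] (v ⪯ w × v ≢ w × w ⪯ leaf y × m ∈ lab w)))

-- ε : X^×_irr → P(M), represented as a map on X × X whose diagonal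
-- values are never used.
IsFitch : ∀ {n k} → (Fin n → Fin n → Subset k) → Set
IsFitch {n} {k} ε =
  Σ (PhyloTree n) λ T → Σ (Fin (PhyloTree.V T) → Subset k) λ lab → Explains T lab ε

N : ∀ {n k} → (Fin n → Fin n → Subset k) → Fin k → Fin n → Pred (Fin n) 0ℓ
N ε m y x = x ≡ y ⊎ (x ≢ y × m ∉ ε x y)

HierarchyLike : ∀ {n k} → (Fin n → Fin n → Subset k) → Set
HierarchyLike ε = ∀ m y m' y' →
  ((N ε m y ∩ N ε m' y') ≐ N ε m y) ⊎
  ((N ε m y ∩ N ε m' y') ≐ N ε m' y') ⊎
  Empty (N ε m y ∩ N ε m' y')

-- Fix an explaining tree (T, λ), a colour m and a leaf y, and let u be the
-- lowest vertex on the path from the root to y that is the root or whose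
-- incoming edge is an m-edge.  A leaf x ≠ y lies below u iff lca(x,y) lies
-- above u, iff the path from lca(x,y) to y has no m-edge, iff m ∉ ε(x,y).
-- Hence N_m[y] is the cluster of u, and any two clusters of a tree are nested
-- or disjoint.
module Submission where

open import Defs hiding (_⪯_)
open import Data.Nat using (ℕ; _≤_)
open import Data.Fin using (Fin; _≟_)
open import Data.Fin.Subset using (Subset; _∈_; _∉_)
open import Data.Fin.Subset.Properties using (_∈?_)
open import Data.Maybe using (Maybe; just; nothing)
open import Data.Maybe.Properties using (just-injective)
open import Data.Product using (_×_; _,_; ∃-syntax; proj₁; proj₂)
open import Data.Sum using (_⊎_; inj₁; inj₂)
open import Data.Empty using (⊥-elim)
open import Function.Bundles using (Equivalence)
open import Level using (0ℓ)
open import Relation.Nullary using (¬_; Dec; yes; no)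
open import Relation.Unary using (Pred; Decidable; _⊆_; _∩_; _≐_; Empty)
open import Relation.Binary.PropositionalEquality using (_≡_; _≢_; refl; sym; trans; subst)

Laminar : ∀ {A : Set} → Pred A 0ℓ → Pred A 0ℓ → Set
Laminar P Q = ((P ∩ Q) ≐ P) ⊎ ((P ∩ Q) ≐ Q) ⊎ Empty (P ∩ Q)

⊆⇒laminar : ∀ {A : Set} {P Q : Pred A 0ℓ} → P ⊆ Q → Laminar P Q
⊆⇒laminar P⊆Q = inj₁ (proj₁ , λ p → p , P⊆Q p)

⊇⇒laminar : ∀ {A : Set} {P Q : Pred A 0ℓ} → Q ⊆ P → Laminar P Q
⊇⇒laminar Q⊆P = inj₂ (inj₁ (proj₂ , λ q → Q⊆P q , q))

laminar-resp-≐ : ∀ {A : Set} {P P′ Q Q′ : Pred A 0ℓ} →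
                 P ≐ P′ → Q ≐ Q′ → Laminar P′ Q′ → Laminar P Q
laminar-resp-≐ (P⊆P′ , P′⊆P) (Q⊆Q′ , Q′⊆Q) (inj₁ (_ , P′⊆Q′)) =
  ⊆⇒laminar λ p → Q′⊆Q (proj₂ (P′⊆Q′ (P⊆P′ p)))
laminar-resp-≐ (P⊆P′ , P′⊆P) (Q⊆Q′ , Q′⊆Q) (inj₂ (inj₁ (_ , Q′⊆P′))) =
  ⊇⇒laminar λ q → P′⊆P (proj₁ (Q′⊆P′ (Q⊆Q′ q)))
laminar-resp-≐ (P⊆P′ , _) (Q⊆Q′ , _) (inj₂ (inj₂ disjoint)) =
  inj₂ (inj₂ λ x (p , q) → disjoint x (P⊆P′ p , Q⊆Q′ q))

module Ancestry {V : ℕ} (parent : Fin V → Maybe (Fin V)) where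

  infix 4 _⪯_
  _⪯_ : Fin V → Fin V → Set
  _⪯_ = Anc parent

  ⪯-trans : ∀ {u v w} → u ⪯ v → v ⪯ w → u ⪯ w
  ⪯-trans u⪯v anc-refl = u⪯v
  ⪯-trans u⪯v (anc-step v⪯p wp) = anc-step (⪯-trans u⪯v v⪯p) wp

  ⪯-parent : ∀ {u w p} → u ⪯ w → parent w ≡ just p → u ≡ w ⊎ u ⪯ p
  ⪯-parent anc-refl _ = inj₁ refl
  ⪯-parent (anc-step u⪯q wq) wp with just-injective (trans (sym wp) wq)
  ... | refl = inj₂ u⪯q

  LowestCommonAncestor : Fin V → Fin V → Fin V → Set
  LowestCommonAncestor v a b = v ⪯ a × v ⪯ b × (∀ z → z ⪯ a → z ⪯ b → z ⪯ v)

  ancestors-comparable : ∀ {a b w} → a ⪯ w → b ⪯ w → a ⪯ b ⊎ b ⪯ a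
  ancestors-comparable anc-refl b⪯w = inj₂ b⪯w
  ancestors-comparable a⪯w@(anc-step _ _) anc-refl = inj₁ a⪯w
  ancestors-comparable (anc-step a⪯p wp) (anc-step b⪯q wq)
    with just-injective (trans (sym wp) wq)
  ... | refl = ancestors-comparable a⪯p b⪯q

module Rooted {V : ℕ} (parent : Fin V → Maybe (Fin V)) (root : Fin V)
              (root-parent : parent root ≡ nothing)
              (root-anc : ∀ v → Anc parent root v) where

  open Ancestry parent

  root-parentless : ∀ {p} → parent root ≢ just p
  root-parentless eq with trans (sym root-parent) eq
  ... | ()

  -- A cycle through u and its parent p rotates to a cycle through p and its
  -- parent, so induction on the path from the root to u reaches the root.
  parent-not-descendant : ∀ {u p} → parent u ≡ just p → ¬ u ⪯ p
  parent-not-descendant {u} = go (root-anc u)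
    where
    go : ∀ {u p} → root ⪯ u → parent u ≡ just p → ¬ u ⪯ p
    go anc-refl up _ = root-parentless up
    go (anc-step root⪯q uq) up u⪯p with just-injective (trans (sym up) uq)
    go (anc-step root⪯p _) up anc-refl | refl = go root⪯p up anc-refl
    go (anc-step root⪯p _) up (anc-step u⪯r pr) | refl =
      go root⪯p pr (⪯-trans (anc-step anc-refl up) u⪯r)

  ⪯-antisym : ∀ {u w} → u ⪯ w → w ⪯ u → u ≡ w
  ⪯-antisym _ anc-refl = refl
  ⪯-antisym u⪯w (anc-step w⪯p up) = ⊥-elim (parent-not-descendant up (⪯-trans u⪯w w⪯p))

  _⪯?_ : ∀ u w → Dec (u ⪯ w)
  u ⪯? w = go (root-anc w)
    where
    go : ∀ {w} → root ⪯ w → Dec (u ⪯ w)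
    go {w} root⪯w with u ≟ w
    ... | yes refl = yes anc-refl
    go anc-refl | no u≢root = no λ u⪯root → u≢root (⪯-antisym u⪯root (root-anc u))
    go (anc-step root⪯p wp) | no u≢w with go root⪯p
    ... | yes u⪯p = yes (anc-step u⪯p wp)
    ... | no u⋠p = no λ u⪯w → case (⪯-parent u⪯w wp)
      where
      case : ¬ (u ≡ _ ⊎ u ⪯ _)
      case (inj₁ u≡w) = u≢w u≡w
      case (inj₂ u⪯p) = u⋠p u⪯p

  lca : ∀ a b → ∃[ v ] LowestCommonAncestor v a b
  lca a b = go (root-anc a)
    where
    go : ∀ {a} → root ⪯ a → ∃[ v ] LowestCommonAncestor v a b
    go {a} root⪯a with a ⪯? b
    ... | yes a⪯b = a , anc-refl , a⪯b , λ _ z⪯a _ → z⪯a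
    go anc-refl | no root⋠b = ⊥-elim (root⋠b (root-anc b))
    go (anc-step root⪯p ap) | no a⋠b with go root⪯p
    ... | v , v⪯p , v⪯b , v-max = v , anc-step v⪯p ap , v⪯b , v-max′
      where
      v-max′ : ∀ z → z ⪯ _ → z ⪯ b → z ⪯ v
      v-max′ z z⪯a z⪯b with ⪯-parent z⪯a ap
      ... | inj₁ refl = ⊥-elim (a⋠b z⪯b)
      ... | inj₂ z⪯p = v-max z z⪯p z⪯b

  NearestAncestor : Pred (Fin V) 0ℓ → Fin V → Fin V → Set
  NearestAncestor P u w =
    u ⪯ w × (u ≡ root ⊎ P u) × (∀ z → u ⪯ z → u ≢ z → z ⪯ w → ¬ P z)

  nearest-ancestor : ∀ {P : Pred (Fin V) 0ℓ} → Decidable P → ∀ w → ∃[ u ] NearestAncestor P u w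
  nearest-ancestor {P} P? w = go (root-anc w)
    where
    empty-interval : ∀ {w} z → w ⪯ z → w ≢ z → z ⪯ w → ¬ P z
    empty-interval z w⪯z w≢z z⪯w = ⊥-elim (w≢z (⪯-antisym w⪯z z⪯w))

    go : ∀ {w} → root ⪯ w → ∃[ u ] NearestAncestor P u w
    go {w} root⪯w with P? w
    ... | yes Pw = w , anc-refl , inj₂ Pw , empty-interval
    go anc-refl | no _ = root , anc-refl , inj₁ refl , empty-interval
    go (anc-step root⪯p wp) | no ¬Pw with go root⪯p
    ... | u , u⪯p , u-top , none = u , anc-step u⪯p wp , u-top , none′
      where
      none′ : ∀ z → u ⪯ z → u ≢ z → z ⪯ _ → ¬ P z
      none′ z u⪯z u≢z z⪯w with ⪯-parent z⪯w wp
      ... | inj₁ refl = ¬Pw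
      ... | inj₂ z⪯p = none z u⪯z u≢z z⪯p

module Clusters {n : ℕ} (T : PhyloTree n) where
  open PhyloTree T
  open Ancestry parent
  open Rooted parent root root-parent root-anc

  clusters-laminar : ∀ u w → Laminar (Cluster T u) (Cluster T w)
  clusters-laminar u w with u ⪯? w | w ⪯? u
  ... | yes u⪯w | _ = ⊇⇒laminar (⪯-trans u⪯w)
  ... | no _ | yes w⪯u = ⊆⇒laminar (⪯-trans w⪯u)
  ... | no u⋠w | no w⋠u = inj₂ (inj₂ λ x (u⪯x , w⪯x) → case (ancestors-comparable u⪯x w⪯x))
    where
    case : ¬ (u ⪯ w ⊎ w ⪯ u)
    case (inj₁ u⪯w) = u⋠w u⪯w
    case (inj₂ w⪯u) = w⋠u w⪯u

  module Explained {k : ℕ} {lab : Fin V → Subset k} {ε : Fin n → Fin n → Subset k}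
                   (explains : Explains T lab ε) (m : Fin k) (y : Fin n) where

    private
      top : ∃[ u ] NearestAncestor (λ v → m ∈ lab v) u (leaf y)
      top = nearest-ancestor (λ v → m ∈? lab v) (leaf y)

    u : Fin V
    u = proj₁ top

    u⪯y : u ⪯ leaf y
    u⪯y = proj₁ (proj₂ top)

    u-root-or-m-edge : u ≡ root ⊎ m ∈ lab u
    u-root-or-m-edge = proj₁ (proj₂ (proj₂ top))

    no-m-edge-below-u : ∀ z → u ⪯ z → u ≢ z → z ⪯ leaf y → m ∉ lab z
    no-m-edge-below-u = proj₂ (proj₂ (proj₂ top))

    Cluster⊆N : Cluster T u ⊆ N ε m y
    Cluster⊆N {x} u⪯x with x ≟ y
    ... | yes x≡y = inj₁ x≡y
    ... | no x≢y with lca (leaf x) (leaf y)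
    ... | v , v⪯x , v⪯y , v-max = inj₂ (x≢y , λ m∈ε → no-m-edge
            (Equivalence.to (explains x y x≢y m v (v⪯x , v⪯y , v-max)) m∈ε))
      where
      u⪯v : u ⪯ v
      u⪯v = v-max u u⪯x u⪯y

      no-m-edge : ¬ (∃[ w ] (v ⪯ w × v ≢ w × w ⪯ leaf y × m ∈ lab w))
      no-m-edge (w , v⪯w , v≢w , w⪯y , m∈w) =
        no-m-edge-below-u w (⪯-trans u⪯v v⪯w) u≢w w⪯y m∈w
        where
        u≢w : u ≢ w
        u≢w refl = v≢w (⪯-antisym v⪯w u⪯v)

    N⊆Cluster : N ε m y ⊆ Cluster T u
    N⊆Cluster (inj₁ refl) = u⪯y
    N⊆Cluster {x} (inj₂ (x≢y , m∉ε)) with lca (leaf x) (leaf y)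
    ... | v , v⪯x , v⪯y , v-max with ancestors-comparable u⪯y v⪯y
    ... | inj₁ u⪯v = ⪯-trans u⪯v v⪯x
    ... | inj₂ v⪯u with u-root-or-m-edge
    ...   | inj₁ u≡root = subst (_⪯ leaf x) (sym u≡root) (root-anc (leaf x))
    ...   | inj₂ m∈u with v ≟ u
    ...     | yes refl = v⪯x
    ...     | no v≢u = ⊥-elim (m∉ε (Equivalence.from
                (explains x y x≢y m v (v⪯x , v⪯y , v-max)) (u , v⪯u , v≢u , u⪯y , m∈u)))

    N≐Cluster : N ε m y ≐ Cluster T u
    N≐Cluster = N⊆Cluster , Cluster⊆N

corollary1 : ∀ {n k : ℕ} → 1 ≤ n → 1 ≤ k →
    (ε : Fin n → Fin n → Subset k) → IsFitch ε →
    HierarchyLike ε ×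
    (∀ (T : PhyloTree n) (lab : Fin (PhyloTree.V T) → Subset k) →
       Explains T lab ε → ∀ (m : Fin k) (y : Fin n) → InClusters T (N ε m y))
corollary1 _ _ ε (T₀ , _ , explains₀) = hierarchyLike , inClusters
  where
  open Clusters using (module Explained)

  inClusters : ∀ T lab → Explains T lab ε → ∀ m y → InClusters T (N ε m y)
  inClusters T _ explains m y = Explained.u T explains m y , Explained.N≐Cluster T explains m y

  hierarchyLike : HierarchyLike ε
  hierarchyLike m y m′ y′ =
    laminar-resp-≐ (Explained.N≐Cluster T₀ explains₀ m y) (Explained.N≐Cluster T₀ explains₀ m′ y′)
      (Clusters.clusters-laminar T₀ _ _)
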